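{- The class of orthogroupoids is a variety, axiomatized by the identities $x''\approx x$; $0+x\approx x$; $x+1\approx 1$; $x+x'\approx 1$; $(((z+y)'+(z+x))'+(z+y)')+z'\approx z'$; $x+(x+y)\approx x+y$; $y+(x+y)\approx x+y$; and $1+x\approx 1$ (where $0$ abbreviates $1'$).
   Context: An orthogroupoid is an algebra $\mathbf D=\langle D,+,',1\rangle$ of type $(2,1,0)$, with $0:=1'$, satisfying: (a) $x''\approx x$; (b) $0+x\approx x$ and $x+1\approx 1$; (c) $x+x'\approx 1$; (d) for all $x,z$: if $x+z=z$ and $x'+z=z$ then $z=1$; (e) $(((z+y)'+(z+x))'+(z+y)')+z'\approx z'$; (f) $x+(x+y)\approx x+y$ and $y+(x+y)\approx x+y$. -}

module Defs where

open import Level using (Level; _⊔_)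
open import Relation.Binary.PropositionalEquality using (_≡_)
open import Data.Product using (_×_)

record Alg (a : Level) : Set (Level.suc a) where
  field
    Carrier : Set a
    _⊕_     : Carrier → Carrier → Carrier
    _′      : Carrier → Carrier
    𝟙       : Carrier
  𝟘 : Carrier
  𝟘 = 𝟙 ′
  infixl 6 _⊕_
  infix  8 _′

IsOrthogroupoid : ∀ {a} → Alg a → Set a
IsOrthogroupoid D =
    (∀ x → x ′ ′ ≡ x)
  × (∀ x → 𝟘 ⊕ x ≡ x)
  × (∀ x → x ⊕ 𝟙 ≡ 𝟙)
  × (∀ x → x ⊕ x ′ ≡ 𝟙)
  × (∀ x z → x ⊕ z ≡ z → x ′ ⊕ z ≡ z → z ≡ 𝟙)
  × (∀ x y z → (((z ⊕ y) ′ ⊕ (z ⊕ x)) ′ ⊕ (z ⊕ y) ′) ⊕ z ′ ≡ z ′)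
  × (∀ x y → x ⊕ (x ⊕ y) ≡ x ⊕ y)
  × (∀ x y → y ⊕ (x ⊕ y) ≡ x ⊕ y)
  where open Alg D

SatisfiesIdentities : ∀ {a} → Alg a → Set a
SatisfiesIdentities D =
    (∀ x → x ′ ′ ≡ x)
  × (∀ x → 𝟘 ⊕ x ≡ x)
  × (∀ x → x ⊕ 𝟙 ≡ 𝟙)
  × (∀ x → x ⊕ x ′ ≡ 𝟙)
  × (∀ x y z → (((z ⊕ y) ′ ⊕ (z ⊕ x)) ′ ⊕ (z ⊕ y) ′) ⊕ z ′ ≡ z ′)
  × (∀ x y → x ⊕ (x ⊕ y) ≡ x ⊕ y)
  × (∀ x y → y ⊕ (x ⊕ y) ≡ x ⊕ y)
  × (∀ x → 𝟙 ⊕ x ≡ 𝟙)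
  where open Alg D

-- The identities other than (d) are common to both lists, so only two facts are
-- needed. Given (d), the identity 1 + x ≈ 1 follows because 1 and 0 = 1' are
-- both below 1 + x. Conversely, from the identities the map ' is antitone for the
-- relation x + z = z, so the hypotheses of (d) give z' + x = x and z' + x' = x';
-- substituting z' for z in (e) with the pair x', x then collapses it to
-- 1 + z = z, whence z = 1.
module Submission where

open import Defs
open import Level using (Level)
open import Data.Product using (_×_; _,_)
open import Relation.Binary.PropositionalEquality using (_≡_; sym; cong; cong₂; subst; module ≡-Reasoning)

module _ {a : Level} (D : Alg a) where
  open Alg D
  open ≡-Reasoning

  ⊕-idem : (∀ x → 𝟘 ⊕ x ≡ x) → (∀ x y → y ⊕ (x ⊕ y) ≡ x ⊕ y) →
           ∀ y → y ⊕ y ≡ y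
  ⊕-idem 𝟘⊕x≡x absorbʳ y = begin
    y ⊕ y         ≡⟨ cong (y ⊕_) (sym (𝟘⊕x≡x y)) ⟩
    y ⊕ (𝟘 ⊕ y)   ≡⟨ absorbʳ 𝟘 y ⟩
    𝟘 ⊕ y         ≡⟨ 𝟘⊕x≡x y ⟩
    y             ∎

  ′-antitone : (∀ x → 𝟘 ⊕ x ≡ x) → (∀ x → x ⊕ 𝟙 ≡ 𝟙) → (∀ x → x ⊕ x ′ ≡ 𝟙) →
               (∀ x y z → (((z ⊕ y) ′ ⊕ (z ⊕ x)) ′ ⊕ (z ⊕ y) ′) ⊕ z ′ ≡ z ′) →
               ∀ p q → p ⊕ q ≡ q → q ′ ⊕ p ′ ≡ p ′
  ′-antitone 𝟘⊕x≡x x⊕𝟙≡𝟙 x⊕x′≡𝟙 e p q p⊕q≡q = begin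
    q ′ ⊕ p ′                                           ≡⟨ cong (_⊕ p ′) (𝟘⊕x≡x (q ′)) ⟨
    (𝟘 ⊕ q ′) ⊕ p ′                                     ≡⟨ cong (λ w → (w ′ ⊕ q ′) ⊕ p ′) (x⊕𝟙≡𝟙 (q ′)) ⟨
    ((q ′ ⊕ 𝟙) ′ ⊕ q ′) ⊕ p ′                           ≡⟨ cong (λ w → ((w ′ ⊕ 𝟙) ′ ⊕ w ′) ⊕ p ′) p⊕q≡q ⟨
    (((p ⊕ q) ′ ⊕ 𝟙) ′ ⊕ (p ⊕ q) ′) ⊕ p ′               ≡⟨ cong (λ w → (((p ⊕ q) ′ ⊕ w) ′ ⊕ (p ⊕ q) ′) ⊕ p ′) (x⊕x′≡𝟙 p) ⟨
    (((p ⊕ q) ′ ⊕ (p ⊕ p ′)) ′ ⊕ (p ⊕ q) ′) ⊕ p ′       ≡⟨ e (p ′) q p ⟩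
    p ′                                                 ∎

  quasi⇒𝟙⊕x≡𝟙 : (∀ x → 𝟘 ⊕ x ≡ x) → (∀ x y → x ⊕ (x ⊕ y) ≡ x ⊕ y) →
                (∀ x z → x ⊕ z ≡ z → x ′ ⊕ z ≡ z → z ≡ 𝟙) →
                ∀ x → 𝟙 ⊕ x ≡ 𝟙
  quasi⇒𝟙⊕x≡𝟙 𝟘⊕x≡x absorbˡ quasi x = quasi 𝟙 (𝟙 ⊕ x) (absorbˡ 𝟙 x) (𝟘⊕x≡x (𝟙 ⊕ x))

  identities⇒quasi : SatisfiesIdentities D → ∀ x z → x ⊕ z ≡ z → x ′ ⊕ z ≡ z → z ≡ 𝟙
  identities⇒quasi (x′′≡x , 𝟘⊕x≡x , x⊕𝟙≡𝟙 , x⊕x′≡𝟙 , e , _ , absorbʳ , 𝟙⊕x≡𝟙) x z x⊕z≡z x′⊕z≡z =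
    begin
      z       ≡⟨ 𝟙⊕z≡z ⟨
      𝟙 ⊕ z   ≡⟨ 𝟙⊕x≡𝟙 z ⟩
      𝟙       ∎
    where
    antitone : ∀ p q → p ⊕ q ≡ q → q ′ ⊕ p ′ ≡ p ′
    antitone = ′-antitone 𝟘⊕x≡x x⊕𝟙≡𝟙 x⊕x′≡𝟙 e

    z′⊕x≡x : z ′ ⊕ x ≡ x
    z′⊕x≡x = subst (λ w → z ′ ⊕ w ≡ w) (x′′≡x x) (antitone (x ′) z x′⊕z≡z)

    z′⊕x′≡x′ : z ′ ⊕ x ′ ≡ x ′
    z′⊕x′≡x′ = antitone x z x⊕z≡z

    𝟙⊕z≡z : 𝟙 ⊕ z ≡ z
    𝟙⊕z≡z = begin
      𝟙 ⊕ z                                                     ≡⟨ cong (_⊕ z) (x⊕x′≡𝟙 x) ⟨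
      (x ⊕ x ′) ⊕ z                                             ≡⟨ cong (λ w → (w ⊕ x ′) ⊕ z) (x′′≡x x) ⟨
      (x ′ ′ ⊕ x ′) ⊕ z                                         ≡⟨ cong (λ w → (w ′ ⊕ x ′) ⊕ z) (⊕-idem 𝟘⊕x≡x absorbʳ (x ′)) ⟨
      ((x ′ ⊕ x ′) ′ ⊕ x ′) ⊕ z                                 ≡⟨ cong₂ (λ u v → ((u ′ ⊕ v) ′ ⊕ u ′) ⊕ z) z′⊕x≡x z′⊕x′≡x′ ⟨
      (((z ′ ⊕ x) ′ ⊕ (z ′ ⊕ x ′)) ′ ⊕ (z ′ ⊕ x) ′) ⊕ z          ≡⟨ cong ((((z ′ ⊕ x) ′ ⊕ (z ′ ⊕ x ′)) ′ ⊕ (z ′ ⊕ x) ′) ⊕_) (x′′≡x z) ⟨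
      (((z ′ ⊕ x) ′ ⊕ (z ′ ⊕ x ′)) ′ ⊕ (z ′ ⊕ x) ′) ⊕ z ′ ′      ≡⟨ e (x ′) x (z ′) ⟩
      z ′ ′                                                     ≡⟨ x′′≡x z ⟩
      z                                                         ∎

corollary2p9 : ∀ {a : Level} (D : Alg a) →
    (IsOrthogroupoid D → SatisfiesIdentities D) × (SatisfiesIdentities D → IsOrthogroupoid D)
corollary2p9 D = orthogroupoid⇒identities , identities⇒orthogroupoid
  where
  orthogroupoid⇒identities : IsOrthogroupoid D → SatisfiesIdentities D
  orthogroupoid⇒identities (x′′≡x , 𝟘⊕x≡x , x⊕𝟙≡𝟙 , x⊕x′≡𝟙 , quasi , e , absorbˡ , absorbʳ) =
    x′′≡x , 𝟘⊕x≡x , x⊕𝟙≡𝟙 , x⊕x′≡𝟙 , e , absorbˡ , absorbʳ , quasi⇒𝟙⊕x≡𝟙 D 𝟘⊕x≡x absorbˡ quasi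

  identities⇒orthogroupoid : SatisfiesIdentities D → IsOrthogroupoid D
  identities⇒orthogroupoid ids@(x′′≡x , 𝟘⊕x≡x , x⊕𝟙≡𝟙 , x⊕x′≡𝟙 , e , absorbˡ , absorbʳ , _) =
    x′′≡x , 𝟘⊕x≡x , x⊕𝟙≡𝟙 , x⊕x′≡𝟙 , identities⇒quasi D ids , e , absorbˡ , absorbʳ
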